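{- Let $n\ge 0$ and $m>1$ be integers, and let $d_{n+2}=|D_{n+2}|$. Then $$d_{n+2}\equiv G(D_n\times D_n)\equiv G(E_{n,m}^c\times E_{n,m}^c)\pmod m$$ and $$d_{n+2}\equiv\sum_{x\in R_n\cap E^c_{n,m}}\ \sum_{y\in E^c_{n,m}}\gamma(x)\cdot G(x,y)\pmod m.$$
   Context: $D_n$ is the set of monotone Boolean functions $\{0,1\}^n\to\{0,1\}$ ($\{0,1\}^n$ ordered componentwise), partially ordered pointwise. $\top,\bot$ are the constant functions $1,0$; $x|y$ and $x\&y$ are pointwise max and min; $\mathrm{re}(x,y)=|\{z\in D_n:x\le z\le y\}|$. For $x,y\in D_n$, $G(x,y)=\mathrm{re}(x|y,\top)\cdot\mathrm{re}(\bot,x\&y)$, and for $A\subseteq D_n\times D_n$, $G(A)=\sum_{(x,y)\in A}G(x,y)$. A permutation $\pi\in S_n$ acts on $g\in D_n$ by $\pi(g)=g\circ\pi$ where $\pi(u)=u\circ\pi$ for $u\in\{0,1\}^n$. $f\sim g$ iff $f=\pi(g)$ for some $\pi\in S_n$; $[f]$ is the class of $f$ and $\gamma(f)=|[f]|$. $E_{n,m}=\{f\in D_n:\gamma(f)\equiv0\pmod m\}$ and $E^c_{n,m}=D_n\setminus E_{n,m}$. $R_n$ is the set of equivalence classes, each identified with its canonical representative, namely its minimal element with respect to a fixed total order on $D_n$ (the paper uses the order obtained by reading the truth table of a function as a binary integer); thus $R_n\subseteq D_n$ contains exactly one element of each class. -}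

module Defs where

open import Data.Bool using (Bool; true; false; _∧_; _∨_; not; if_then_else_)
open import Data.Nat using (ℕ; zero; suc; _%_; _≡ᵇ_; NonZero)
open import Data.Fin using (Fin; _≟_)
open import Data.Vec using (Vec; []; _∷_; lookup; tabulate)
open import Data.List using (List; []; _∷_; map; _++_; concatMap; length; filterᵇ; allFin)
open import Data.Bool.ListAction using (all; any)
open import Data.Nat.ListAction using (sum)
open import Relation.Nullary.Decidable using (⌊_⌋)

Pt : ℕ → Set
Pt n = Vec Bool n

BF : ℕ → Set
BF n = Pt n → Bool

-- all points of {0,1}^n, in binary counting order (first coordinate most
-- significant, false = 0 before true = 1)
allPts : (n : ℕ) → List (Pt n)
allPts zero = [] ∷ []
allPts (suc n) = map (false ∷_) (allPts n) ++ map (true ∷_) (allPts n)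

glue : {n : ℕ} → BF n → BF n → BF (suc n)
glue f₀ f₁ (false ∷ v) = f₀ v
glue f₀ f₁ (true ∷ v) = f₁ v

-- all Boolean functions of n variables (each exactly once up to
-- extensional equality)
allBF : (n : ℕ) → List (BF n)
allBF zero = (λ _ → false) ∷ (λ _ → true) ∷ []
allBF (suc n) = concatMap (λ f₀ → map (glue f₀) (allBF n)) (allBF n)

_≤b_ : Bool → Bool → Bool
false ≤b _ = true
true ≤b b = b

leqPt : {n : ℕ} → Pt n → Pt n → Bool
leqPt [] [] = true
leqPt (a ∷ u) (b ∷ v) = (a ≤b b) ∧ leqPt u v

leqF : {n : ℕ} → BF n → BF n → Bool
leqF {n} f g = all (λ u → f u ≤b g u) (allPts n)

eqF : {n : ℕ} → BF n → BF n → Bool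
eqF f g = leqF f g ∧ leqF g f

isMonotone : {n : ℕ} → BF n → Bool
isMonotone {n} f =
  all (λ u → all (λ v → not (leqPt u v) ∨ (f u ≤b f v)) (allPts n)) (allPts n)

D : (n : ℕ) → List (BF n)
D n = filterᵇ isMonotone (allBF n)

d : ℕ → ℕ
d n = length (D n)

⊤F : {n : ℕ} → BF n
⊤F _ = true

⊥F : {n : ℕ} → BF n
⊥F _ = false

_∣F_ : {n : ℕ} → BF n → BF n → BF n
(f ∣F g) u = f u ∨ g u

_&F_ : {n : ℕ} → BF n → BF n → BF n
(f &F g) u = f u ∧ g u

re : {n : ℕ} → BF n → BF n → ℕ
re {n} x y = length (filterᵇ (λ z → leqF x z ∧ leqF z y) (D n))

G : {n : ℕ} → BF n → BF n → ℕ
G x y = re (x ∣F y) ⊤F Data.Nat.* re ⊥F (x &F y)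

G× : {n : ℕ} → List (BF n) → List (BF n) → ℕ
G× A B = sum (map (λ x → sum (map (λ y → G x y) B)) A)

-- permutations of Fin n, as vectors (π(0),…,π(n-1)) with distinct entries
allVecs : {A : Set} → List A → (k : ℕ) → List (Vec A k)
allVecs xs zero = [] ∷ []
allVecs xs (suc k) = concatMap (λ a → map (a ∷_) (allVecs xs k)) xs

isInjective : {n : ℕ} → Vec (Fin n) n → Bool
isInjective {n} π =
  all (λ i → all (λ j → ⌊ i ≟ j ⌋ ∨ not ⌊ lookup π i ≟ lookup π j ⌋) (allFin n)) (allFin n)

Perms : (n : ℕ) → List (Vec (Fin n) n)
Perms n = filterᵇ isInjective (allVecs (allFin n) n)

actPt : {n : ℕ} → Vec (Fin n) n → Pt n → Pt n
actPt π u = tabulate (λ i → lookup u (lookup π i))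

act : {n : ℕ} → Vec (Fin n) n → BF n → BF n
act π g u = g (actPt π u)

equiv : {n : ℕ} → BF n → BF n → Bool
equiv {n} f g = any (λ π → eqF f (act π g)) (Perms n)

γ : {n : ℕ} → BF n → ℕ
γ {n} f = length (filterᵇ (λ g → equiv g f) (D n))

inEc : {n : ℕ} (m : ℕ) .{{_ : NonZero m}} → BF n → Bool
inEc m f = not ((γ f % m) ≡ᵇ 0)

Ec : (n m : ℕ) .{{_ : NonZero m}} → List (BF n)
Ec n m = filterᵇ (inEc m) (D n)

-- Truth table of f: values listed along allPts n; read as a binary integer
-- with the first entry most significant.  Comparing equal-length tables
-- lexicographically (false < true) is comparing these integers.
truthTable : {n : ℕ} → BF n → List Bool
truthTable {n} f = map f (allPts n)

lexLeq : List Bool → List Bool → Bool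
lexLeq [] _ = true
lexLeq (_ ∷ _) [] = false
lexLeq (false ∷ as) (true ∷ bs) = true
lexLeq (true ∷ as) (false ∷ bs) = false
lexLeq (false ∷ as) (false ∷ bs) = lexLeq as bs
lexLeq (true ∷ as) (true ∷ bs) = lexLeq as bs

isCanonical : {n : ℕ} → BF n → Bool
isCanonical {n} x =
  all (λ g → not (equiv g x) ∨ lexLeq (truthTable x) (truthTable g)) (D n)

R : (n : ℕ) → List (BF n)
R n = filterᵇ isCanonical (D n)

REc : (n m : ℕ) .{{_ : NonZero m}} → List (BF n)
REc n m = filterᵇ (inEc m) (R n)

-- A monotone function of n + 2 variables amounts to four monotone functions a, b, c, e
-- of n variables (its restrictions to the values of the first two variables) with
-- a ≤ b, a ≤ c, b ≤ e and c ≤ e.  For a fixed middle pair (b, c) the admissible a form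
-- the interval [⊥, b & c] and the admissible e the interval [b | c, ⊤], whence
-- d (n + 2) = Σ_{b,c ∈ D n} G (b, c).
-- G is invariant under the diagonal action of S_n, so its row and column sums over the
-- invariant sets D n and E^c_{n,m} are class functions.  A class function H satisfies
-- Σ_{D n} H = Σ_{r ∈ R n} γ(r) H(r); the terms with x or y outside E^c_{n,m} therefore
-- vanish modulo m, and grouping the remaining x by their canonical representative gives
-- the last formula.

module Submission where

open import Defs
open import Algebra.Bundles using (CommutativeMonoid)
import Algebra.Solver.IdempotentCommutativeMonoid as ∧-Solver
open import Data.Bool using (Bool; true; false; T; T?; _∧_; _∨_; not)
open import Data.Bool.Properties
  using (T-∧; T-≡; ∧-identityʳ; ∧-idem; ∧-comm; ∨-comm; ∧-commutativeMonoid; ∧-idempotentCommutativeMonoid)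
open import Data.Bool.ListAction using (all; and)
open import Data.Empty using (⊥-elim)
open import Data.Fin as Fin using (Fin; _≟_; punchOut; #_)
open import Data.Fin.Properties using (any?; punchOut-injective; injective⇒≤)
open import Data.List using (List; []; _∷_; map; _++_; concatMap; length; filterᵇ; allFin)
open import Data.List.Membership.Propositional using (_∈_; find; lose)
open import Data.List.Membership.Propositional.Properties
  using (∈-map⁺; ∈-++⁺ˡ; ∈-++⁺ʳ; ∈-concatMap⁺; ∈-filter⁺; ∈-filter⁻; ∈-allFin)
import Data.List.Extrema as Extrema
open import Data.List.Properties using (map-++; map-cong; map-cong-local; filter-≐; ∷-injective)
import Data.List.Relation.Unary.All as All
open import Data.List.Relation.Unary.All.Properties using (all⁺; all⁻)
open import Data.List.Relation.Unary.Any as Any using (here; there)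
open import Data.List.Relation.Unary.Any.Properties using (any⁺; any⁻)
open import Data.Nat using (ℕ; zero; suc; _+_; _*_; _%_; _<_; NonZero; _≡ᵇ_)
open import Data.Nat.DivMod using ([m+kn]%n≡m%n)
open import Data.Nat.Divisibility using (_∣_; divides-refl; _∣0; ∣m∣n⇒∣m+n; ∣m⇒∣m*n; m%n≡0⇒n∣m)
open import Data.Nat.ListAction using (sum)
open import Data.Nat.ListAction.Properties using (sum-++)
open import Data.Nat.Properties
  using (*-assoc; *-comm; *-distribˡ-+; *-identityˡ; *-zeroʳ; +-assoc; +-identityʳ; <-irrefl; ≡ᵇ⇒≡;
         +-commutativeSemigroup; *-commutativeSemigroup)
open import Algebra.Properties.CommutativeSemigroup +-commutativeSemigroup
  using () renaming (interchange to +-interchange)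
open import Algebra.Properties.CommutativeSemigroup *-commutativeSemigroup
  using () renaming (x∙yz≈y∙xz to *-left-comm)
open import Algebra.Properties.CommutativeSemigroup (CommutativeMonoid.commutativeSemigroup ∧-commutativeMonoid)
  using () renaming (interchange to ∧-interchange)
open import Data.Product using (∃-syntax; _×_; _,_; proj₁; proj₂)
open import Data.Sum using (_⊎_; inj₁; inj₂)
open import Data.Vec using (Vec; []; _∷_; lookup; tabulate)
open import Data.Vec.Properties using (lookup∘tabulate; tabulate∘lookup; tabulate-cong)
open import Function using (_∘_; Equivalence)
open Equivalence using (to; from)
open import Function.Definitions using (Injective)
open import Relation.Binary.Bundles using (TotalOrder)
open import Relation.Binary.Core using (_Preserves_⟶_)
open import Level using (0ℓ)
open import Relation.Binary.PropositionalEquality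
open import Relation.Nullary using (yes; no)
open import Relation.Nullary.Decidable using (⌊_⌋; toWitness; fromWitness)

∑ : {A : Set} → List A → (A → ℕ) → ℕ
∑ xs f = sum (map f xs)

∑-syntax : {A : Set} → List A → (A → ℕ) → ℕ
∑-syntax = ∑

infix 5 ∑-syntax
syntax ∑-syntax xs (λ x → e) = ∑[ x ∈ xs ] e

𝟙 : Bool → ℕ
𝟙 true = 1
𝟙 false = 0

𝟙-∧ : ∀ a b → 𝟙 (a ∧ b) ≡ 𝟙 a * 𝟙 b
𝟙-∧ true b = sym (+-identityʳ (𝟙 b))
𝟙-∧ false b = refl

module _ {A : Set} where

  ∑-cong : {f g : A → ℕ} (xs : List A) → f ≗ g → ∑ xs f ≡ ∑ xs g
  ∑-cong xs f≗g = cong sum (map-cong f≗g xs)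

  ∑-cong-∈ : {f g : A → ℕ} (xs : List A) → (∀ {x} → x ∈ xs → f x ≡ g x) → ∑ xs f ≡ ∑ xs g
  ∑-cong-∈ xs f≡g = cong sum (map-cong-local (All.tabulate f≡g))

  ∑-++ : (xs ys : List A) (f : A → ℕ) → ∑ (xs ++ ys) f ≡ ∑ xs f + ∑ ys f
  ∑-++ xs ys f = trans (cong sum (map-++ f xs ys)) (sum-++ (map f xs) (map f ys))

  ∑-0 : (xs : List A) → ∑[ x ∈ xs ] 0 ≡ 0
  ∑-0 [] = refl
  ∑-0 (x ∷ xs) = ∑-0 xs

  ∑-+ : (xs : List A) (f g : A → ℕ) → ∑[ x ∈ xs ] (f x + g x) ≡ ∑ xs f + ∑ xs g
  ∑-+ [] f g = refl
  ∑-+ (x ∷ xs) f g = trans (cong (f x + g x +_) (∑-+ xs f g))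
                           (+-interchange (f x) (g x) (∑ xs f) (∑ xs g))

  ∑-*ˡ : (c : ℕ) (xs : List A) (f : A → ℕ) → c * ∑ xs f ≡ ∑[ x ∈ xs ] c * f x
  ∑-*ˡ c [] f = *-zeroʳ c
  ∑-*ˡ c (x ∷ xs) f = trans (*-distribˡ-+ c (f x) (∑ xs f)) (cong (c * f x +_) (∑-*ˡ c xs f))

  ∑-*ʳ : (c : ℕ) (xs : List A) (f : A → ℕ) → ∑ xs f * c ≡ ∑[ x ∈ xs ] f x * c
  ∑-*ʳ c xs f = trans (*-comm (∑ xs f) c) (trans (∑-*ˡ c xs f) (∑-cong xs (λ x → *-comm c (f x))))

  ∑-filterᵇ : (p : A → Bool) (xs : List A) (f : A → ℕ) →
    ∑ (filterᵇ p xs) f ≡ ∑[ x ∈ xs ] 𝟙 (p x) * f x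
  ∑-filterᵇ p [] f = refl
  ∑-filterᵇ p (x ∷ xs) f with p x
  ... | true = cong₂ _+_ (sym (+-identityʳ (f x))) (∑-filterᵇ p xs f)
  ... | false = ∑-filterᵇ p xs f

  length-filterᵇ : (p : A → Bool) (xs : List A) → length (filterᵇ p xs) ≡ ∑[ x ∈ xs ] 𝟙 (p x)
  length-filterᵇ p [] = refl
  length-filterᵇ p (x ∷ xs) with p x
  ... | true = cong suc (length-filterᵇ p xs)
  ... | false = length-filterᵇ p xs

  ∑-split : (p : A → Bool) (xs : List A) (f : A → ℕ) →
    ∑ xs f ≡ (∑[ x ∈ xs ] 𝟙 (p x) * f x) + (∑[ x ∈ xs ] 𝟙 (not (p x)) * f x)
  ∑-split p xs f = trans (∑-cong xs 𝟙-partition) (∑-+ xs _ _)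
    where
    𝟙-partition : ∀ x → f x ≡ 𝟙 (p x) * f x + 𝟙 (not (p x)) * f x
    𝟙-partition x with p x
    ... | true = sym (trans (+-identityʳ (f x + 0)) (+-identityʳ (f x)))
    ... | false = sym (+-identityʳ (f x))

  ∑-∣ : (m : ℕ) (xs : List A) (f : A → ℕ) → (∀ {x} → x ∈ xs → m ∣ f x) → m ∣ ∑ xs f
  ∑-∣ m [] f m∣f = m ∣0
  ∑-∣ m (x ∷ xs) f m∣f = ∣m∣n⇒∣m+n (m∣f (here refl)) (∑-∣ m xs f (m∣f ∘ there))

module _ {A B : Set} where

  ∑-map : (g : A → B) (xs : List A) (f : B → ℕ) → ∑ (map g xs) f ≡ ∑[ x ∈ xs ] f (g x)
  ∑-map g [] f = refl
  ∑-map g (x ∷ xs) f = cong (f (g x) +_) (∑-map g xs f)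

  ∑-concatMap : (h : A → List B) (xs : List A) (f : B → ℕ) →
    ∑ (concatMap h xs) f ≡ ∑[ x ∈ xs ] ∑ (h x) f
  ∑-concatMap h [] f = refl
  ∑-concatMap h (x ∷ xs) f =
    trans (∑-++ (h x) (concatMap h xs) f) (cong (∑ (h x) f +_) (∑-concatMap h xs f))

  ∑-comm : (xs : List A) (ys : List B) (f : A → B → ℕ) →
    ∑[ x ∈ xs ] ∑[ y ∈ ys ] f x y ≡ ∑[ y ∈ ys ] ∑[ x ∈ xs ] f x y
  ∑-comm [] ys f = sym (∑-0 ys)
  ∑-comm (x ∷ xs) ys f =
    trans (cong (∑ ys (f x) +_) (∑-comm xs ys f)) (sym (∑-+ ys (f x) (λ y → ∑[ x ∈ xs ] f x y)))

  ∑-*-∑ : (xs : List A) (ys : List B) (f : A → ℕ) (g : B → ℕ) →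
    ∑ xs f * ∑ ys g ≡ ∑[ x ∈ xs ] ∑[ y ∈ ys ] f x * g y
  ∑-*-∑ xs ys f g = trans (∑-*ʳ (∑ ys g) xs f) (∑-cong xs (λ x → ∑-*ˡ (f x) ys g))


T⇔⇒≡ : {a b : Bool} → (T a → T b) → (T b → T a) → a ≡ b
T⇔⇒≡ {false} {false} _ _ = refl
T⇔⇒≡ {false} {true} _ b⇒a = ⊥-elim (b⇒a _)
T⇔⇒≡ {true} {false} a⇒b _ = ⊥-elim (a⇒b _)
T⇔⇒≡ {true} {true} _ _ = refl

T-not-∨⁺ : {a b : Bool} → (T a → T b) → T (not a ∨ b)
T-not-∨⁺ {false} _ = _
T-not-∨⁺ {true} a⇒b = a⇒b _

T-not-∨⁻ : {a b : Bool} → T (not a ∨ b) → T a → T b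
T-not-∨⁻ {true} b _ = b

T-∨-not⁺ : {a b : Bool} → (T b → T a) → T (a ∨ not b)
T-∨-not⁺ {true} _ = _
T-∨-not⁺ {false} {false} _ = _
T-∨-not⁺ {false} {true} b⇒a = b⇒a _

T-∨-not⁻ : {a b : Bool} → T (a ∨ not b) → T b → T a
T-∨-not⁻ {true} _ _ = _
T-∨-not⁻ {false} {false} _ ()

all-∈⁺ : {A : Set} (p : A → Bool) (xs : List A) → (∀ {x} → x ∈ xs → T (p x)) → T (all p xs)
all-∈⁺ p xs p-holds = all⁻ p {xs = xs} (All.tabulate p-holds)

all-∈⁻ : {A : Set} (p : A → Bool) {xs : List A} {x : A} → T (all p xs) → x ∈ xs → T (p x)
all-∈⁻ p {xs} all-p = All.lookup (all⁺ p xs all-p)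

filterᵇ-cong : {A : Set} {p q : A → Bool} → p ≗ q → filterᵇ p ≗ filterᵇ q
filterᵇ-cong {p = p} {q} p≗q = filter-≐ (T? ∘ p) (T? ∘ q)
  ((λ {x} → subst T (p≗q x)) , (λ {x} → subst T (sym (p≗q x))))

all-cong : {A : Set} {p q : A → Bool} (xs : List A) → p ≗ q → all p xs ≡ all q xs
all-cong xs p≗q = cong and (map-cong p≗q xs)

all-∧ : {A : Set} (p q : A → Bool) (xs : List A) → all (λ x → p x ∧ q x) xs ≡ all p xs ∧ all q xs
all-∧ p q [] = refl
all-∧ p q (x ∷ xs) = trans (cong ((p x ∧ q x) ∧_) (all-∧ p q xs)) (∧-interchange (p x) (q x) (all p xs) (all q xs))

map-≡⇒≗ : {A B : Set} {f g : A → B} (xs : List A) → map f xs ≡ map g xs → ∀ {x} → x ∈ xs → f x ≡ g x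
map-≡⇒≗ (y ∷ ys) fxs≡gxs (here refl) = proj₁ (∷-injective fxs≡gxs)
map-≡⇒≗ (y ∷ ys) fxs≡gxs (there x∈) = map-≡⇒≗ ys (proj₂ (∷-injective fxs≡gxs)) x∈

≤b-refl : ∀ a → T (a ≤b a)
≤b-refl false = _
≤b-refl true = _

≤b-trans : ∀ {a b c} → T (a ≤b b) → T (b ≤b c) → T (a ≤b c)
≤b-trans {false} _ _ = _
≤b-trans {true} {true} _ b≤c = b≤c

≤b-antisym : ∀ {a b} → T (a ≤b b) → T (b ≤b a) → a ≡ b
≤b-antisym {false} {false} _ _ = refl
≤b-antisym {true} {true} _ _ = refl

≤b-true : ∀ a → T (a ≤b true)
≤b-true false = _
≤b-true true = _

∨-≤b : ∀ a b c → ((a ∨ b) ≤b c) ≡ (a ≤b c) ∧ (b ≤b c)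
∨-≤b false b c = refl
∨-≤b true false c = sym (∧-identityʳ c)
∨-≤b true true c = sym (∧-idem c)

≤b-∧ : ∀ a b c → (a ≤b (b ∧ c)) ≡ (a ≤b b) ∧ (a ≤b c)
≤b-∧ false b c = refl
≤b-∧ true b c = refl

∈-allPts : {n : ℕ} (u : Pt n) → u ∈ allPts n
∈-allPts [] = here refl
∈-allPts {suc n} (false ∷ u) = ∈-++⁺ˡ (∈-map⁺ (false ∷_) (∈-allPts u))
∈-allPts {suc n} (true ∷ u) = ∈-++⁺ʳ (map (false ∷_) (allPts n)) (∈-map⁺ (true ∷_) (∈-allPts u))

leqPt-refl : {n : ℕ} (u : Pt n) → T (leqPt u u)
leqPt-refl [] = _
leqPt-refl (a ∷ u) = from (T-∧ {a ≤b a}) (≤b-refl a , leqPt-refl u)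

leqPt⁺ : {k : ℕ} (u v : Pt k) → (∀ i → T (lookup u i ≤b lookup v i)) → T (leqPt u v)
leqPt⁺ [] [] _ = _
leqPt⁺ (a ∷ u) (b ∷ v) u≤v = from (T-∧ {a ≤b b}) (u≤v Fin.zero , leqPt⁺ u v (u≤v ∘ Fin.suc))

leqPt⁻ : {k : ℕ} (u v : Pt k) → T (leqPt u v) → ∀ i → T (lookup u i ≤b lookup v i)
leqPt⁻ (a ∷ u) (b ∷ v) u≤v Fin.zero = proj₁ (to (T-∧ {a ≤b b}) u≤v)
leqPt⁻ (a ∷ u) (b ∷ v) u≤v (Fin.suc i) = leqPt⁻ u v (proj₂ (to (T-∧ {a ≤b b}) u≤v)) i

module _ {n : ℕ} where

  all-allPts⁺ : (p : Pt n → Bool) → (∀ u → T (p u)) → T (all p (allPts n))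
  all-allPts⁺ p p-holds = all-∈⁺ p (allPts n) (λ {u} _ → p-holds u)

  all-allPts⁻ : (p : Pt n → Bool) → T (all p (allPts n)) → ∀ u → T (p u)
  all-allPts⁻ p all-p u = all-∈⁻ p all-p (∈-allPts u)

  _≤ᶠ_ : BF n → BF n → Set
  f ≤ᶠ g = ∀ u → T (f u ≤b g u)

  Monotone : BF n → Set
  Monotone f = ∀ u v → T (leqPt u v) → T (f u ≤b f v)

  leqF⁺ : (f g : BF n) → f ≤ᶠ g → T (leqF f g)
  leqF⁺ f g = all-allPts⁺ (λ u → f u ≤b g u)

  leqF⁻ : (f g : BF n) → T (leqF f g) → f ≤ᶠ g
  leqF⁻ f g = all-allPts⁻ (λ u → f u ≤b g u)

  eqF⁺ : (f g : BF n) → f ≗ g → T (eqF f g)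
  eqF⁺ f g f≗g = from (T-∧ {leqF f g})
    ( leqF⁺ f g (λ u → subst (λ b → T (f u ≤b b)) (f≗g u) (≤b-refl (f u)))
    , leqF⁺ g f (λ u → subst (λ b → T (g u ≤b b)) (sym (f≗g u)) (≤b-refl (g u))))

  eqF⁻ : (f g : BF n) → T (eqF f g) → f ≗ g
  eqF⁻ f g f≡g u = let f≤g , g≤f = to (T-∧ {leqF f g}) f≡g in
    ≤b-antisym (leqF⁻ f g f≤g u) (leqF⁻ g f g≤f u)

  isMonotone⁺ : (f : BF n) → Monotone f → T (isMonotone f)
  isMonotone⁺ f mono = all-allPts⁺ _ (λ u → all-allPts⁺ _ (λ v → T-not-∨⁺ (mono u v)))

  isMonotone⁻ : (f : BF n) → T (isMonotone f) → Monotone f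
  isMonotone⁻ f mono u v = T-not-∨⁻ (all-allPts⁻ _ (all-allPts⁻ _ mono u) v)

  leqF-cong : {f f′ g g′ : BF n} → f ≗ f′ → g ≗ g′ → leqF f g ≡ leqF f′ g′
  leqF-cong f≗f′ g≗g′ = all-cong (allPts n) (λ u → cong₂ _≤b_ (f≗f′ u) (g≗g′ u))

  isMonotone-cong : {f g : BF n} → f ≗ g → isMonotone f ≡ isMonotone g
  isMonotone-cong f≗g = all-cong (allPts n) (λ u → all-cong (allPts n) (λ v →
    cong (λ b → not (leqPt u v) ∨ b) (cong₂ _≤b_ (f≗g u) (f≗g v))))

-- Splitting off the first variable

_↾_ : {n : ℕ} → BF (suc n) → Bool → BF n
(f ↾ b) u = f (b ∷ u)

module _ {n : ℕ} where

  all-allPts-suc : (p : Pt (suc n) → Bool) →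
    all p (allPts (suc n)) ≡ all (p ∘ (false ∷_)) (allPts n) ∧ all (p ∘ (true ∷_)) (allPts n)
  all-allPts-suc p = T⇔⇒≡
    (λ all-p → from T-∧ ( all-allPts⁺ p₀ (all-allPts⁻ p all-p ∘ (false ∷_))
                        , all-allPts⁺ p₁ (all-allPts⁻ p all-p ∘ (true ∷_))))
    (λ all-p₀₁ → let all-p₀ , all-p₁ = to (T-∧ {all p₀ (allPts n)}) all-p₀₁ in all-allPts⁺ p λ
      { (false ∷ u) → all-allPts⁻ p₀ all-p₀ u ; (true ∷ u) → all-allPts⁻ p₁ all-p₁ u })
    where
    p₀ p₁ : Pt n → Bool
    p₀ u = p (false ∷ u)
    p₁ u = p (true ∷ u)

  leqF-glue : (a b c e : BF n) → leqF (glue a b) (glue c e) ≡ leqF a c ∧ leqF b e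
  leqF-glue a b c e = all-allPts-suc _

  eqF-glue : (f : BF (suc n)) (a b : BF n) → eqF f (glue a b) ≡ eqF (f ↾ false) a ∧ eqF (f ↾ true) b
  eqF-glue f a b = T⇔⇒≡
    (λ f≡ab → let f≗ab = eqF⁻ f (glue a b) f≡ab in
      from T-∧ (eqF⁺ (f ↾ false) a (f≗ab ∘ (false ∷_)) , eqF⁺ (f ↾ true) b (f≗ab ∘ (true ∷_))))
    (λ f≡ab → let f₀≡a , f₁≡b = to (T-∧ {eqF (f ↾ false) a}) f≡ab in eqF⁺ f (glue a b) λ
      { (false ∷ u) → eqF⁻ (f ↾ false) a f₀≡a u ; (true ∷ u) → eqF⁻ (f ↾ true) b f₁≡b u })

  glue-monotone : {a b : BF n} → Monotone a → Monotone b → a ≤ᶠ b → Monotone (glue a b)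
  glue-monotone mono-a mono-b a≤b (false ∷ u) (false ∷ v) u≤v = mono-a u v u≤v
  glue-monotone {a} mono-a mono-b a≤b (false ∷ u) (true ∷ v) u≤v = ≤b-trans {a u} (mono-a u v u≤v) (a≤b v)
  glue-monotone mono-a mono-b a≤b (true ∷ u) (true ∷ v) u≤v = mono-b u v u≤v

  isMonotone-glue : (a b : BF n) → isMonotone (glue a b) ≡ isMonotone a ∧ (isMonotone b ∧ leqF a b)
  isMonotone-glue a b = T⇔⇒≡ restrict extend
    where
    restrict : T (isMonotone (glue a b)) → T (isMonotone a ∧ (isMonotone b ∧ leqF a b))
    restrict mono-ab = let mono = isMonotone⁻ (glue a b) mono-ab in from T-∧
      ( isMonotone⁺ a (λ u v → mono (false ∷ u) (false ∷ v))
      , from T-∧ ( isMonotone⁺ b (λ u v → mono (true ∷ u) (true ∷ v))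
                 , leqF⁺ a b (λ u → mono (false ∷ u) (true ∷ u) (leqPt-refl u))))
    extend : T (isMonotone a ∧ (isMonotone b ∧ leqF a b)) → T (isMonotone (glue a b))
    extend mono-a∧mono-b∧a≤b =
      let mono-a , mono-b∧a≤b = to (T-∧ {isMonotone a}) mono-a∧mono-b∧a≤b
          mono-b , a≤b = to (T-∧ {isMonotone b}) mono-b∧a≤b
      in isMonotone⁺ (glue a b)
           (glue-monotone (isMonotone⁻ a mono-a) (isMonotone⁻ b mono-b) (leqF⁻ a b a≤b))

  leqF-∣F : (b c e : BF n) → leqF (b ∣F c) e ≡ leqF b e ∧ leqF c e
  leqF-∣F b c e = trans (all-cong (allPts n) (λ u → ∨-≤b (b u) (c u) (e u))) (all-∧ _ _ (allPts n))

  leqF-&F : (a b c : BF n) → leqF a (b &F c) ≡ leqF a b ∧ leqF a c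
  leqF-&F a b c = trans (all-cong (allPts n) (λ u → ≤b-∧ (a u) (b u) (c u))) (all-∧ _ _ (allPts n))

  leqF-⊤F : (e : BF n) → leqF e ⊤F ≡ true
  leqF-⊤F e = T⇔⇒≡ _ (λ _ → leqF⁺ e ⊤F (≤b-true ∘ e))

  leqF-⊥F : (a : BF n) → leqF ⊥F a ≡ true
  leqF-⊥F a = T⇔⇒≡ _ (λ _ → leqF⁺ ⊥F a _)

∑-allBF-suc : {n : ℕ} (h : BF (suc n) → ℕ) →
  ∑ (allBF (suc n)) h ≡ ∑[ a ∈ allBF n ] ∑[ b ∈ allBF n ] h (glue a b)
∑-allBF-suc {n} h = trans (∑-concatMap (λ a → map (glue a) (allBF n)) (allBF n) h)
  (∑-cong (allBF n) (λ a → ∑-map (glue a) (allBF n) h))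

∑-eqF-allBF : (n : ℕ) (f : BF n) → ∑[ g ∈ allBF n ] 𝟙 (eqF f g) ≡ 1
∑-eqF-allBF zero f with f []
... | false = refl
... | true = refl
∑-eqF-allBF (suc n) f = begin
  ∑[ g ∈ allBF (suc n) ] 𝟙 (eqF f g)
    ≡⟨ ∑-allBF-suc (λ g → 𝟙 (eqF f g)) ⟩
  ∑[ a ∈ allBF n ] ∑[ b ∈ allBF n ] 𝟙 (eqF f (glue a b))
    ≡⟨ ∑-cong (allBF n) (λ a → ∑-cong (allBF n) (λ b →
         trans (cong 𝟙 (eqF-glue f a b)) (𝟙-∧ (eqF (f ↾ false) a) _))) ⟩
  ∑[ a ∈ allBF n ] ∑[ b ∈ allBF n ] 𝟙 (eqF (f ↾ false) a) * 𝟙 (eqF (f ↾ true) b)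
    ≡⟨ sym (∑-*-∑ (allBF n) (allBF n) _ _) ⟩
  (∑[ a ∈ allBF n ] 𝟙 (eqF (f ↾ false) a)) * (∑[ b ∈ allBF n ] 𝟙 (eqF (f ↾ true) b))
    ≡⟨ cong₂ _*_ (∑-eqF-allBF n (f ↾ false)) (∑-eqF-allBF n (f ↾ true)) ⟩
  1 ∎
  where open ≡-Reasoning

-- Counting monotone functions of n + 2 variables

∧-rearrange : ∀ ma mb mc me lab lac lbe lce →
  (ma ∧ (mb ∧ lab)) ∧ ((mc ∧ (me ∧ lce)) ∧ (lac ∧ lbe))
  ≡ (mb ∧ mc) ∧ ((ma ∧ (lab ∧ lac)) ∧ (me ∧ (lbe ∧ lce)))
∧-rearrange ma mb mc me lab lac lbe lce =
  prove 8 ((Ma ⊕ (Mb ⊕ Lab)) ⊕ ((Mc ⊕ (Me ⊕ Lce)) ⊕ (Lac ⊕ Lbe)))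
          ((Mb ⊕ Mc) ⊕ ((Ma ⊕ (Lab ⊕ Lac)) ⊕ (Me ⊕ (Lbe ⊕ Lce))))
          (ma ∷ mb ∷ mc ∷ me ∷ lab ∷ lac ∷ lbe ∷ lce ∷ [])
  where
  open ∧-Solver ∧-idempotentCommutativeMonoid
  Ma Mb Mc Me Lab Lac Lbe Lce : Expr 8
  Ma = var (# 0); Mb = var (# 1); Mc = var (# 2); Me = var (# 3)
  Lab = var (# 4); Lac = var (# 5); Lbe = var (# 6); Lce = var (# 7)

𝟙-∧³ : ∀ a b c → 𝟙 (a ∧ (b ∧ c)) ≡ 𝟙 a * (𝟙 b * 𝟙 c)
𝟙-∧³ a b c = trans (𝟙-∧ a (b ∧ c)) (cong (𝟙 a *_) (𝟙-∧ b c))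

module _ {n : ℕ} where

  ∑-D : (f : BF n → ℕ) → ∑ (D n) f ≡ ∑[ x ∈ allBF n ] 𝟙 (isMonotone x) * f x
  ∑-D = ∑-filterᵇ isMonotone (allBF n)

  ∑-D² : (F : BF n → BF n → ℕ) →
    ∑[ x ∈ D n ] ∑[ y ∈ D n ] F x y ≡ ∑[ x ∈ allBF n ] ∑[ y ∈ allBF n ] 𝟙 (isMonotone x ∧ isMonotone y) * F x y
  ∑-D² F = begin
    ∑[ x ∈ D n ] ∑[ y ∈ D n ] F x y
      ≡⟨ ∑-D _ ⟩
    ∑[ x ∈ allBF n ] 𝟙 (isMonotone x) * (∑[ y ∈ D n ] F x y)
      ≡⟨ ∑-cong (allBF n) (λ x → cong (𝟙 (isMonotone x) *_) (∑-D (F x))) ⟩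
    ∑[ x ∈ allBF n ] 𝟙 (isMonotone x) * (∑[ y ∈ allBF n ] 𝟙 (isMonotone y) * F x y)
      ≡⟨ ∑-cong (allBF n) (λ x → ∑-*ˡ (𝟙 (isMonotone x)) (allBF n) _) ⟩
    ∑[ x ∈ allBF n ] ∑[ y ∈ allBF n ] 𝟙 (isMonotone x) * (𝟙 (isMonotone y) * F x y)
      ≡⟨ ∑-cong (allBF n) (λ x → ∑-cong (allBF n) (λ y →
           trans (sym (*-assoc (𝟙 (isMonotone x)) _ (F x y))) (cong (_* F x y) (sym (𝟙-∧ (isMonotone x) _))))) ⟩
    ∑[ x ∈ allBF n ] ∑[ y ∈ allBF n ] 𝟙 (isMonotone x ∧ isMonotone y) * F x y ∎
    where open ≡-Reasoning

  re-allBF : (x y : BF n) → re x y ≡ ∑[ z ∈ allBF n ] 𝟙 (isMonotone z ∧ (leqF x z ∧ leqF z y))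
  re-allBF x y = begin
    re x y
      ≡⟨ length-filterᵇ _ (D n) ⟩
    ∑[ z ∈ D n ] 𝟙 (leqF x z ∧ leqF z y)
      ≡⟨ ∑-D _ ⟩
    ∑[ z ∈ allBF n ] 𝟙 (isMonotone z) * 𝟙 (leqF x z ∧ leqF z y)
      ≡⟨ ∑-cong (allBF n) (λ z → sym (𝟙-∧ (isMonotone z) _)) ⟩
    ∑[ z ∈ allBF n ] 𝟙 (isMonotone z ∧ (leqF x z ∧ leqF z y)) ∎
    where open ≡-Reasoning

  re-⊤F : (x : BF n) → re x ⊤F ≡ ∑[ e ∈ allBF n ] 𝟙 (isMonotone e ∧ leqF x e)
  re-⊤F x = trans (re-allBF x ⊤F) (∑-cong (allBF n) (λ e →
    cong (λ b → 𝟙 (isMonotone e ∧ b)) (trans (cong (leqF x e ∧_) (leqF-⊤F e)) (∧-identityʳ (leqF x e)))))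

  re-⊥F : (y : BF n) → re ⊥F y ≡ ∑[ a ∈ allBF n ] 𝟙 (isMonotone a ∧ leqF a y)
  re-⊥F y = trans (re-allBF ⊥F y) (∑-cong (allBF n) (λ a →
    cong (λ b → 𝟙 (isMonotone a ∧ (b ∧ leqF a y))) (leqF-⊥F a)))

  G-as-double-sum : (b c : BF n) → G b c
    ≡ ∑[ a ∈ allBF n ] ∑[ e ∈ allBF n ] 𝟙 (isMonotone a ∧ leqF a (b &F c)) * 𝟙 (isMonotone e ∧ leqF (b ∣F c) e)
  G-as-double-sum b c = begin
    re (b ∣F c) ⊤F * re ⊥F (b &F c) ≡⟨ *-comm (re (b ∣F c) ⊤F) (re ⊥F (b &F c)) ⟩
    re ⊥F (b &F c) * re (b ∣F c) ⊤F ≡⟨ cong₂ _*_ (re-⊥F (b &F c)) (re-⊤F (b ∣F c)) ⟩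
    ∑ (allBF n) below * ∑ (allBF n) above ≡⟨ ∑-*-∑ (allBF n) (allBF n) below above ⟩
    ∑[ a ∈ allBF n ] ∑[ e ∈ allBF n ] below a * above e ∎
    where
    open ≡-Reasoning
    below above : BF n → ℕ
    below a = 𝟙 (isMonotone a ∧ leqF a (b &F c))
    above e = 𝟙 (isMonotone e ∧ leqF (b ∣F c) e)

  isMonotone-glue² : (a b c e : BF n) → isMonotone (glue (glue a b) (glue c e))
    ≡ (isMonotone b ∧ isMonotone c) ∧ ((isMonotone a ∧ leqF a (b &F c)) ∧ (isMonotone e ∧ leqF (b ∣F c) e))
  isMonotone-glue² a b c e = begin
    isMonotone (glue (glue a b) (glue c e))
      ≡⟨ isMonotone-glue (glue a b) (glue c e) ⟩
    isMonotone (glue a b) ∧ (isMonotone (glue c e) ∧ leqF (glue a b) (glue c e))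
      ≡⟨ cong₂ _∧_ (isMonotone-glue a b) (cong₂ _∧_ (isMonotone-glue c e) (leqF-glue a b c e)) ⟩
    (M a ∧ (M b ∧ leqF a b)) ∧ ((M c ∧ (M e ∧ leqF c e)) ∧ (leqF a c ∧ leqF b e))
      ≡⟨ ∧-rearrange (M a) (M b) (M c) (M e) (leqF a b) (leqF a c) (leqF b e) (leqF c e) ⟩
    (M b ∧ M c) ∧ ((M a ∧ (leqF a b ∧ leqF a c)) ∧ (M e ∧ (leqF b e ∧ leqF c e)))
      ≡⟨ cong (λ z → (M b ∧ M c) ∧ z)
           (sym (cong₂ (λ l u → (M a ∧ l) ∧ (M e ∧ u)) (leqF-&F a b c) (leqF-∣F b c e))) ⟩
    (M b ∧ M c) ∧ ((M a ∧ leqF a (b &F c)) ∧ (M e ∧ leqF (b ∣F c) e)) ∎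
    where
    open ≡-Reasoning
    M : BF n → Bool
    M = isMonotone

d-suc-suc : (n : ℕ) → d (suc (suc n)) ≡ G× (D n) (D n)
d-suc-suc n = begin
  d (suc (suc n))
    ≡⟨ length-filterᵇ isMonotone (allBF (suc (suc n))) ⟩
  ∑[ f ∈ allBF (suc (suc n)) ] 𝟙 (M f)
    ≡⟨ ∑-allBF-suc {suc n} (λ f → 𝟙 (M f)) ⟩
  ∑[ f₀ ∈ allBF (suc n) ] ∑[ f₁ ∈ allBF (suc n) ] 𝟙 (M (glue f₀ f₁))
    ≡⟨ ∑-allBF-suc (λ f₀ → ∑[ f₁ ∈ allBF (suc n) ] 𝟙 (M (glue f₀ f₁))) ⟩
  ∑[ a ∈ A ] ∑[ b ∈ A ] ∑[ f₁ ∈ allBF (suc n) ] 𝟙 (M (glue (glue a b) f₁))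
    ≡⟨ ∑-cong A (λ a → ∑-cong A (λ b → ∑-allBF-suc (λ f₁ → 𝟙 (M (glue (glue a b) f₁))))) ⟩
  ∑[ a ∈ A ] ∑[ b ∈ A ] ∑[ c ∈ A ] ∑[ e ∈ A ] 𝟙 (M (glue (glue a b) (glue c e)))
    ≡⟨ ∑-cong A (λ a → ∑-cong A (λ b → ∑-cong A (λ c → ∑-cong A (λ e → factor a b c e)))) ⟩
  ∑[ a ∈ A ] ∑[ b ∈ A ] ∑[ c ∈ A ] ∑[ e ∈ A ] S a b c e
    ≡⟨ ∑-comm A A (λ a b → ∑[ c ∈ A ] ∑[ e ∈ A ] S a b c e) ⟩
  ∑[ b ∈ A ] ∑[ a ∈ A ] ∑[ c ∈ A ] ∑[ e ∈ A ] S a b c e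
    ≡⟨ ∑-cong A (λ b → ∑-comm A A (λ a c → ∑[ e ∈ A ] S a b c e)) ⟩
  ∑[ b ∈ A ] ∑[ c ∈ A ] ∑[ a ∈ A ] ∑[ e ∈ A ] S a b c e
    ≡⟨ ∑-cong A (λ b → ∑-cong A (λ c → pull-out b c)) ⟩
  ∑[ b ∈ A ] ∑[ c ∈ A ] 𝟙 (M b ∧ M c) * G b c
    ≡⟨ sym (∑-D² {n} G) ⟩
  G× (D n) (D n) ∎
  where
  open ≡-Reasoning
  A : List (BF n)
  A = allBF n
  M : {k : ℕ} → BF k → Bool
  M = isMonotone
  S : BF n → BF n → BF n → BF n → ℕ
  S a b c e = 𝟙 (M b ∧ M c) * (𝟙 (M a ∧ leqF a (b &F c)) * 𝟙 (M e ∧ leqF (b ∣F c) e))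
  factor : ∀ a b c e → 𝟙 (M (glue (glue a b) (glue c e))) ≡ S a b c e
  factor a b c e = trans (cong 𝟙 (isMonotone-glue² a b c e))
    (𝟙-∧³ (M b ∧ M c) (M a ∧ leqF a (b &F c)) (M e ∧ leqF (b ∣F c) e))
  pull-out : ∀ b c → ∑[ a ∈ A ] ∑[ e ∈ A ] S a b c e ≡ 𝟙 (M b ∧ M c) * G b c
  pull-out b c = begin
    ∑[ a ∈ A ] ∑[ e ∈ A ] k * P a e   ≡⟨ ∑-cong A (λ a → sym (∑-*ˡ k A (P a))) ⟩
    ∑[ a ∈ A ] k * (∑[ e ∈ A ] P a e) ≡⟨ sym (∑-*ˡ k A (λ a → ∑[ e ∈ A ] P a e)) ⟩
    k * (∑[ a ∈ A ] ∑[ e ∈ A ] P a e) ≡⟨ cong (k *_) (sym (G-as-double-sum b c)) ⟩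
    k * G b c ∎
    where
    k : ℕ
    k = 𝟙 (M b ∧ M c)
    P : BF n → BF n → ℕ
    P a e = 𝟙 (M a ∧ leqF a (b &F c)) * 𝟙 (M e ∧ leqF (b ∣F c) e)

-- Permutations of the variables

allVecs-complete : {A : Set} (xs : List A) {k : ℕ} (v : Vec A k) → (∀ i → lookup v i ∈ xs) → v ∈ allVecs xs k
allVecs-complete xs [] _ = here refl
allVecs-complete xs {suc k} (a ∷ v) entries∈ = ∈-concatMap⁺ (λ b → map (b ∷_) (allVecs xs k))
  (Any.map (λ { refl → ∈-map⁺ (a ∷_) (allVecs-complete xs v (entries∈ ∘ Fin.suc)) }) (entries∈ Fin.zero))

injective⇒surjective : {n : ℕ} (f : Fin n → Fin n) → Injective _≡_ _≡_ f → ∀ j → ∃[ i ] f i ≡ j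
injective⇒surjective {zero} f _ ()
injective⇒surjective {suc n} f f-inj j with any? (λ i → f i ≟ j)
... | yes j∈image = j∈image
... | no j∉image = ⊥-elim (<-irrefl refl (injective⇒≤ {f = g} g-inj))
  where
  f≢j : ∀ i → j ≢ f i
  f≢j i j≡fi = j∉image (i , sym j≡fi)
  g : Fin (suc n) → Fin n
  g i = punchOut (f≢j i)
  g-inj : Injective _≡_ _≡_ g
  g-inj {i} {k} gi≡gk = f-inj (punchOut-injective (f≢j i) (f≢j k) gi≡gk)

module _ {n : ℕ} where

  IsPermutation : Vec (Fin n) n → Set
  IsPermutation π = Injective _≡_ _≡_ (lookup π)

  private
    injectiveAt : Vec (Fin n) n → Fin n → Fin n → Bool
    injectiveAt π i j = ⌊ i ≟ j ⌋ ∨ not ⌊ lookup π i ≟ lookup π j ⌋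

  isInjective⁺ : (π : Vec (Fin n) n) → IsPermutation π → T (isInjective π)
  isInjective⁺ π π-perm = all-∈⁺ _ (allFin n) (λ {i} _ → all-∈⁺ (injectiveAt π i) (allFin n) (λ {j} _ →
    T-∨-not⁺ {⌊ i ≟ j ⌋} (fromWitness ∘ π-perm ∘ toWitness)))

  isInjective⁻ : (π : Vec (Fin n) n) → T (isInjective π) → IsPermutation π
  isInjective⁻ π inj {i} {j} πi≡πj = toWitness (T-∨-not⁻ {⌊ i ≟ j ⌋}
    (all-∈⁻ (injectiveAt π i) (all-∈⁻ (λ i → all (injectiveAt π i) (allFin n)) inj (∈-allFin i)) (∈-allFin j))
    (fromWitness πi≡πj))

  ∈-Perms⁺ : (π : Vec (Fin n) n) → IsPermutation π → π ∈ Perms n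
  ∈-Perms⁺ π π-perm =
    ∈-filter⁺ (T? ∘ isInjective) (allVecs-complete (allFin n) π (∈-allFin ∘ lookup π)) (isInjective⁺ π π-perm)

  ∈-Perms⁻ : {π : Vec (Fin n) n} → π ∈ Perms n → IsPermutation π
  ∈-Perms⁻ {π} π∈ = isInjective⁻ π (proj₂ (∈-filter⁻ (T? ∘ isInjective) {xs = allVecs (allFin n) n} π∈))

  _⊙_ : Vec (Fin n) n → Vec (Fin n) n → Vec (Fin n) n
  π ⊙ σ = tabulate (λ i → lookup π (lookup σ i))

  identity : Vec (Fin n) n
  identity = tabulate (λ i → i)

  identity-isPermutation : IsPermutation identity
  identity-isPermutation {i} {j} eq = trans (sym (lookup∘tabulate _ i)) (trans eq (lookup∘tabulate _ j))

  ⊙-isPermutation : {π σ : Vec (Fin n) n} → IsPermutation π → IsPermutation σ → IsPermutation (π ⊙ σ)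
  ⊙-isPermutation π-perm σ-perm {i} {j} eq =
    σ-perm (π-perm (trans (sym (lookup∘tabulate _ i)) (trans eq (lookup∘tabulate _ j))))

  actPt-⊙ : (π σ : Vec (Fin n) n) (u : Pt n) → actPt (π ⊙ σ) u ≡ actPt σ (actPt π u)
  actPt-⊙ π σ u = tabulate-cong (λ i → trans (cong (lookup u) (lookup∘tabulate _ i))
                                       (sym (lookup∘tabulate _ (lookup σ i))))

  actPt-fixed : (π : Vec (Fin n) n) → (∀ i → lookup π i ≡ i) → (u : Pt n) → actPt π u ≡ u
  actPt-fixed π π≗id u = trans (tabulate-cong (λ i → cong (lookup u) (π≗id i))) (tabulate∘lookup u)

  actPt-identity : (u : Pt n) → actPt identity u ≡ u
  actPt-identity = actPt-fixed identity (lookup∘tabulate _)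

  inverse : (π : Vec (Fin n) n) → IsPermutation π → Vec (Fin n) n
  inverse π π-perm = tabulate (λ j → proj₁ (injective⇒surjective (lookup π) π-perm j))

  module _ (π : Vec (Fin n) n) (π-perm : IsPermutation π) where

    private
      π⁻¹ : Vec (Fin n) n
      π⁻¹ = inverse π π-perm

    lookup-inverseʳ : ∀ j → lookup π (lookup π⁻¹ j) ≡ j
    lookup-inverseʳ j = trans (cong (lookup π) (lookup∘tabulate _ j))
                              (proj₂ (injective⇒surjective (lookup π) π-perm j))

    lookup-inverseˡ : ∀ i → lookup π⁻¹ (lookup π i) ≡ i
    lookup-inverseˡ i = π-perm (lookup-inverseʳ (lookup π i))

    inverse-isPermutation : IsPermutation π⁻¹
    inverse-isPermutation {i} {j} eq =
      trans (sym (lookup-inverseʳ i)) (trans (cong (lookup π) eq) (lookup-inverseʳ j))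

    actPt-inverseˡ : (u : Pt n) → actPt π⁻¹ (actPt π u) ≡ u
    actPt-inverseˡ u = trans (sym (actPt-⊙ π π⁻¹ u))
      (actPt-fixed (π ⊙ π⁻¹) (λ i → trans (lookup∘tabulate _ i) (lookup-inverseʳ i)) u)

    actPt-inverseʳ : (u : Pt n) → actPt π (actPt π⁻¹ u) ≡ u
    actPt-inverseʳ u = trans (sym (actPt-⊙ π⁻¹ π u))
      (actPt-fixed (π⁻¹ ⊙ π) (λ i → trans (lookup∘tabulate _ i) (lookup-inverseˡ i)) u)

  -- A record rather than a Σ-type, so that f and g can be inferred from f ∼ g.
  record _∼_ (f g : BF n) : Set where
    constructor mk∼
    field
      permutation : Vec (Fin n) n
      isPermutation : IsPermutation permutation
      ≗-act : f ≗ act permutation g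

  equiv⁺ : (f g : BF n) → f ∼ g → T (equiv f g)
  equiv⁺ f g (mk∼ π π-perm f≗πg) =
    any⁺ (λ π → eqF f (act π g)) (lose (∈-Perms⁺ π π-perm) (eqF⁺ f (act π g) f≗πg))

  equiv⁻ : (f g : BF n) → T (equiv f g) → f ∼ g
  equiv⁻ f g f≡g with find (any⁻ (λ π → eqF f (act π g)) (Perms n) f≡g)
  ... | π , π∈ , f≡πg = mk∼ π (∈-Perms⁻ π∈) (eqF⁻ f (act π g) f≡πg)

  ≗⇒∼ : {f g : BF n} → f ≗ g → f ∼ g
  ≗⇒∼ {f} {g} f≗g = mk∼ identity identity-isPermutation λ u → trans (f≗g u) (cong g (sym (actPt-identity u)))

  ∼-refl : {f : BF n} → f ∼ f
  ∼-refl = ≗⇒∼ (λ _ → refl)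

  ∼-sym : {f g : BF n} → f ∼ g → g ∼ f
  ∼-sym {f} {g} (mk∼ π π-perm f≗πg) = mk∼ (inverse π π-perm) (inverse-isPermutation π π-perm)
    λ u → trans (cong g (sym (actPt-inverseʳ π π-perm u))) (sym (f≗πg (actPt (inverse π π-perm) u)))

  ∼-trans : {f g h : BF n} → f ∼ g → g ∼ h → f ∼ h
  ∼-trans {h = h} (mk∼ π π-perm f≗πg) (mk∼ σ σ-perm g≗σh) = mk∼ (π ⊙ σ) (⊙-isPermutation {π} {σ} π-perm σ-perm)
    λ u → trans (f≗πg u) (trans (g≗σh (actPt π u)) (cong h (sym (actPt-⊙ π σ u))))

  equiv-resp-∼ : {f f′ g g′ : BF n} → f ∼ f′ → g ∼ g′ → equiv f g ≡ equiv f′ g′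
  equiv-resp-∼ {f} {f′} {g} {g′} f∼f′ g∼g′ = T⇔⇒≡
    (λ f≡g → equiv⁺ f′ g′ (∼-trans (∼-sym f∼f′) (∼-trans (equiv⁻ f g f≡g) g∼g′)))
    (λ f′≡g′ → equiv⁺ f g (∼-trans f∼f′ (∼-trans (equiv⁻ f′ g′ f′≡g′) (∼-sym g∼g′))))

  γ-resp-∼ : γ Preserves _∼_ ⟶ _≡_
  γ-resp-∼ x∼y = cong length (filterᵇ-cong (λ g → equiv-resp-∼ ∼-refl x∼y) (D n))

  inEc-resp-∼ : (m : ℕ) .{{_ : NonZero m}} → inEc m Preserves _∼_ ⟶ _≡_
  inEc-resp-∼ m x∼y = cong (λ k → not ((k % m) ≡ᵇ 0)) (γ-resp-∼ x∼y)

module _ {n : ℕ} where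

  ∈D⇒isMonotone : {f : BF n} → f ∈ D n → T (isMonotone f)
  ∈D⇒isMonotone f∈ = proj₂ (∈-filter⁻ (T? ∘ isMonotone) {xs = allBF n} f∈)

  ∑-eqF-D : (f : BF n) → T (isMonotone f) → ∑[ g ∈ D n ] 𝟙 (eqF f g) ≡ 1
  ∑-eqF-D f mono-f = begin
    ∑[ g ∈ D n ] 𝟙 (eqF f g)                         ≡⟨ ∑-D (λ g → 𝟙 (eqF f g)) ⟩
    ∑[ g ∈ allBF n ] 𝟙 (isMonotone g) * 𝟙 (eqF f g) ≡⟨ ∑-cong (allBF n) equal⇒monotone ⟩
    ∑[ g ∈ allBF n ] 𝟙 (eqF f g)                     ≡⟨ ∑-eqF-allBF n f ⟩
    1 ∎
    where
    open ≡-Reasoning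
    equal⇒monotone : ∀ g → 𝟙 (isMonotone g) * 𝟙 (eqF f g) ≡ 𝟙 (eqF f g)
    equal⇒monotone g with eqF f g in f≡g
    ... | false = *-zeroʳ (𝟙 (isMonotone g))
    ... | true = cong (λ b → 𝟙 b * 1)
      (trans (isMonotone-cong (λ u → sym (eqF⁻ f g (from T-≡ f≡g) u))) (to T-≡ mono-f))

  ∑-D-sift : (F : BF n → ℕ) → F Preserves _≗_ ⟶ _≡_ → {y : BF n} → T (isMonotone y) →
    ∑[ z ∈ D n ] 𝟙 (eqF y z) * F z ≡ F y
  ∑-D-sift F F-ext {y} mono-y = begin
    ∑[ z ∈ D n ] 𝟙 (eqF y z) * F z   ≡⟨ ∑-cong (D n) replace ⟩
    ∑[ z ∈ D n ] 𝟙 (eqF y z) * F y   ≡⟨ sym (∑-*ʳ (F y) (D n) _) ⟩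
    (∑[ z ∈ D n ] 𝟙 (eqF y z)) * F y ≡⟨ cong (_* F y) (∑-eqF-D y mono-y) ⟩
    1 * F y                          ≡⟨ *-identityˡ (F y) ⟩
    F y ∎
    where
    open ≡-Reasoning
    replace : ∀ z → 𝟙 (eqF y z) * F z ≡ 𝟙 (eqF y z) * F y
    replace z with eqF y z in y≡z
    ... | false = refl
    ... | true = cong (_+ 0) (F-ext (λ u → sym (eqF⁻ y z (from T-≡ y≡z) u)))

  actPt-mono : (π : Vec (Fin n) n) {u v : Pt n} → T (leqPt u v) → T (leqPt (actPt π u) (actPt π v))
  actPt-mono π {u} {v} u≤v = leqPt⁺ (actPt π u) (actPt π v) (λ i →
    subst₂ (λ a b → T (a ≤b b)) (sym (lookup∘tabulate _ i)) (sym (lookup∘tabulate _ i))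
           (leqPt⁻ u v u≤v (lookup π i)))

  isMonotone-act : (π : Vec (Fin n) n) (g : BF n) → T (isMonotone g) → T (isMonotone (act π g))
  isMonotone-act π g mono = isMonotone⁺ (act π g) (λ u v u≤v →
    isMonotone⁻ g mono (actPt π u) (actPt π v) (actPt-mono π {u} {v} u≤v))

  module _ (π : Vec (Fin n) n) (π-perm : IsPermutation π) where

    private
      π⁻¹ : Vec (Fin n) n
      π⁻¹ = inverse π π-perm

    leqF-act : (f g : BF n) → leqF (act π f) (act π g) ≡ leqF f g
    leqF-act f g = T⇔⇒≡
      (λ πf≤πg → leqF⁺ f g (λ u → subst (λ w → T (f w ≤b g w)) (actPt-inverseʳ π π-perm u)
                                        (leqF⁻ (act π f) (act π g) πf≤πg (actPt π⁻¹ u))))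
      (λ f≤g → leqF⁺ (act π f) (act π g) (λ u → leqF⁻ f g f≤g (actPt π u)))

    eqF-act-transpose : (y z : BF n) → eqF (act π y) z ≡ eqF (act π⁻¹ z) y
    eqF-act-transpose y z = T⇔⇒≡
      (λ πy≡z → eqF⁺ (act π⁻¹ z) y (λ u →
        trans (sym (eqF⁻ (act π y) z πy≡z (actPt π⁻¹ u))) (cong y (actPt-inverseʳ π π-perm u))))
      (λ π⁻¹z≡y → eqF⁺ (act π y) z (λ u →
        trans (sym (eqF⁻ (act π⁻¹ z) y π⁻¹z≡y (actPt π u))) (cong z (actPt-inverseˡ π π-perm u))))

    -- act π permutes D n only up to ≗, so each term is first sifted through the
    -- unique element of D n that is ≗ to act π y.
    ∑-D-act : (F : BF n → ℕ) → F Preserves _≗_ ⟶ _≡_ → ∑[ y ∈ D n ] F (act π y) ≡ ∑ (D n) F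
    ∑-D-act F F-ext = begin
      ∑[ y ∈ D n ] F (act π y)
        ≡⟨ ∑-cong-∈ (D n) (λ {y} y∈ → sym (∑-D-sift F F-ext (isMonotone-act π y (∈D⇒isMonotone y∈)))) ⟩
      ∑[ y ∈ D n ] ∑[ z ∈ D n ] 𝟙 (eqF (act π y) z) * F z
        ≡⟨ ∑-comm (D n) (D n) (λ y z → 𝟙 (eqF (act π y) z) * F z) ⟩
      ∑[ z ∈ D n ] ∑[ y ∈ D n ] 𝟙 (eqF (act π y) z) * F z
        ≡⟨ ∑-cong (D n) (λ z → sym (∑-*ʳ (F z) (D n) (λ y → 𝟙 (eqF (act π y) z)))) ⟩
      ∑[ z ∈ D n ] (∑[ y ∈ D n ] 𝟙 (eqF (act π y) z)) * F z
        ≡⟨ ∑-cong-∈ (D n) (λ z∈ → cong (_* _) (unique-preimage z∈)) ⟩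
      ∑[ z ∈ D n ] 1 * F z
        ≡⟨ ∑-cong (D n) (λ z → *-identityˡ (F z)) ⟩
      ∑ (D n) F ∎
      where
      open ≡-Reasoning
      unique-preimage : {z : BF n} → z ∈ D n → ∑[ y ∈ D n ] 𝟙 (eqF (act π y) z) ≡ 1
      unique-preimage {z} z∈ = trans (∑-cong (D n) (λ y → cong 𝟙 (eqF-act-transpose y z)))
        (∑-eqF-D (act π⁻¹ z) (isMonotone-act π⁻¹ z (∈D⇒isMonotone z∈)))

    re-act : (a b : BF n) → re (act π a) (act π b) ≡ re a b
    re-act a b = begin
      re (act π a) (act π b)                          ≡⟨ length-filterᵇ _ (D n) ⟩
      ∑[ z ∈ D n ] 𝟙 (between (act π a) (act π b) z) ≡⟨ sym (∑-D-act _ between-ext) ⟩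
      ∑[ z ∈ D n ] 𝟙 (between (act π a) (act π b) (act π z))
        ≡⟨ ∑-cong (D n) (λ z → cong 𝟙 (cong₂ _∧_ (leqF-act a z) (leqF-act z b))) ⟩
      ∑[ z ∈ D n ] 𝟙 (between a b z)                  ≡⟨ sym (length-filterᵇ _ (D n)) ⟩
      re a b ∎
      where
      open ≡-Reasoning
      between : BF n → BF n → BF n → Bool
      between x y z = leqF x z ∧ leqF z y
      between-ext : (λ z → 𝟙 (between (act π a) (act π b) z)) Preserves _≗_ ⟶ _≡_
      between-ext z≗z′ = cong 𝟙 (cong₂ _∧_ (leqF-cong (λ _ → refl) z≗z′) (leqF-cong z≗z′ (λ _ → refl)))

    G-act : (x y : BF n) → G (act π x) (act π y) ≡ G x y
    G-act x y = cong₂ _*_ (re-act (x ∣F y) ⊤F) (re-act ⊥F (x &F y))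

  re-cong : {x x′ y y′ : BF n} → x ≗ x′ → y ≗ y′ → re x y ≡ re x′ y′
  re-cong x≗x′ y≗y′ = cong length (filterᵇ-cong
    (λ z → cong₂ _∧_ (leqF-cong x≗x′ (λ _ → refl)) (leqF-cong (λ _ → refl) y≗y′)) (D n))

  G-cong : {x x′ y y′ : BF n} → x ≗ x′ → y ≗ y′ → G x y ≡ G x′ y′
  G-cong x≗x′ y≗y′ = cong₂ _*_ (re-cong (λ u → cong₂ _∨_ (x≗x′ u) (y≗y′ u)) (λ _ → refl))
                                (re-cong (λ _ → refl) (λ u → cong₂ _∧_ (x≗x′ u) (y≗y′ u)))

  G-comm : (x y : BF n) → G x y ≡ G y x
  G-comm x y = cong₂ _*_ (re-cong (λ u → ∨-comm (x u) (y u)) (λ _ → refl))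
                         (re-cong (λ _ → refl) (λ u → ∧-comm (x u) (y u)))

-- Canonical representatives

lexLeq-refl : ∀ as → T (lexLeq as as)
lexLeq-refl [] = _
lexLeq-refl (false ∷ as) = lexLeq-refl as
lexLeq-refl (true ∷ as) = lexLeq-refl as

lexLeq-trans : ∀ {as bs cs} → T (lexLeq as bs) → T (lexLeq bs cs) → T (lexLeq as cs)
lexLeq-trans {[]} _ _ = _
lexLeq-trans {a ∷ as} {b ∷ bs} {c ∷ cs} = step a b c
  where
  step : ∀ a b c → T (lexLeq (a ∷ as) (b ∷ bs)) → T (lexLeq (b ∷ bs) (c ∷ cs)) → T (lexLeq (a ∷ as) (c ∷ cs))
  step false false false = lexLeq-trans {as}
  step false false true _ _ = _
  step false true true _ _ = _
  step true true true = lexLeq-trans {as}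

lexLeq-antisym : ∀ {as bs} → T (lexLeq as bs) → T (lexLeq bs as) → as ≡ bs
lexLeq-antisym {[]} {[]} _ _ = refl
lexLeq-antisym {false ∷ as} {false ∷ bs} as≤bs bs≤as = cong (false ∷_) (lexLeq-antisym as≤bs bs≤as)
lexLeq-antisym {true ∷ as} {true ∷ bs} as≤bs bs≤as = cong (true ∷_) (lexLeq-antisym as≤bs bs≤as)

lexLeq-total : ∀ as bs → T (lexLeq as bs) ⊎ T (lexLeq bs as)
lexLeq-total [] bs = inj₁ _
lexLeq-total (a ∷ as) [] = inj₂ _
lexLeq-total (false ∷ as) (false ∷ bs) = lexLeq-total as bs
lexLeq-total (false ∷ as) (true ∷ bs) = inj₁ _
lexLeq-total (true ∷ as) (false ∷ bs) = inj₂ _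
lexLeq-total (true ∷ as) (true ∷ bs) = lexLeq-total as bs

lexLeq-totalOrder : TotalOrder 0ℓ 0ℓ 0ℓ
lexLeq-totalOrder = record
  { Carrier = List Bool
  ; _≈_ = _≡_
  ; _≤_ = λ as bs → T (lexLeq as bs)
  ; isTotalOrder = record
    { isPartialOrder = record
      { isPreorder = record
        { isEquivalence = isEquivalence
        ; reflexive = λ { {as} refl → lexLeq-refl as }
        ; trans = λ {as} → lexLeq-trans {as}
        }
      ; antisym = lexLeq-antisym
      }
    ; total = lexLeq-total
    }
  }

open Extrema lexLeq-totalOrder using (argmin; argmin-all; f[argmin]≤f[xs])

module _ {n : ℕ} where

  truthTable-injective : (x y : BF n) → truthTable x ≡ truthTable y → x ≗ y
  truthTable-injective x y tx≡ty u = map-≡⇒≗ (allPts n) tx≡ty (∈-allPts u)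

  isCanonical⁻ : {r g : BF n} → T (isCanonical r) → g ∈ D n → g ∼ r →
    T (lexLeq (truthTable r) (truthTable g))
  isCanonical⁻ {r} {g} r-canonical g∈ g∼r = T-not-∨⁻ {equiv g r}
    (all-∈⁻ (λ g → not (equiv g r) ∨ lexLeq (truthTable r) (truthTable g)) r-canonical g∈)
    (equiv⁺ g r g∼r)

  isCanonical-cong : {x y : BF n} → x ≗ y → isCanonical x ≡ isCanonical y
  isCanonical-cong x≗y = all-cong (D n) (λ g → cong₂ (λ a b → not a ∨ b)
    (equiv-resp-∼ ∼-refl (≗⇒∼ x≗y)) (cong (λ t → lexLeq t (truthTable g)) (map-cong x≗y (allPts n))))

  -- The witness is the member of the class of x with the least truth table.
  canonical-exists : {x : BF n} → x ∈ D n → ∃[ r ] r ∈ D n × T (isCanonical r) × r ∼ x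
  canonical-exists {x} x∈ = r , r∈D , r-canonical , r∼x
    where
    class : List (BF n)
    class = filterᵇ (λ g → equiv g x) (D n)
    ∈class⁻ : ∀ {g} → g ∈ class → g ∈ D n × g ∼ x
    ∈class⁻ {g} g∈ = let g∈D , g≡x = ∈-filter⁻ (T? ∘ (λ g → equiv g x)) {xs = D n} g∈ in
      g∈D , equiv⁻ g x g≡x
    r : BF n
    r = argmin truthTable x class
    r∈D×r∼x : r ∈ D n × r ∼ x
    r∈D×r∼x = argmin-all truthTable (x∈ , ∼-refl) (All.tabulate ∈class⁻)
    r∈D : r ∈ D n
    r∈D = proj₁ r∈D×r∼x
    r∼x : r ∼ x
    r∼x = proj₂ r∈D×r∼x
    r-minimal : ∀ {g} → g ∈ D n → g ∼ x → T (lexLeq (truthTable r) (truthTable g))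
    r-minimal {g} g∈ g∼x = All.lookup (f[argmin]≤f[xs] {f = truthTable} x class)
      (∈-filter⁺ (T? ∘ (λ g → equiv g x)) g∈ (equiv⁺ g x g∼x))
    r-canonical : T (isCanonical r)
    r-canonical = all-∈⁺ (λ g → not (equiv g r) ∨ lexLeq (truthTable r) (truthTable g)) (D n)
      (λ {g} g∈ → T-not-∨⁺ {equiv g r} (λ g≡r → r-minimal g∈ (∼-trans (equiv⁻ g r g≡r) r∼x)))

  canonical-unique : {r r′ : BF n} → r ∈ D n → r′ ∈ D n → T (isCanonical r) → T (isCanonical r′) →
    r ∼ r′ → r ≗ r′
  canonical-unique {r} {r′} r∈ r′∈ r-canonical r′-canonical r∼r′ = truthTable-injective r r′
    (lexLeq-antisym (isCanonical⁻ r-canonical r′∈ (∼-sym r∼r′)) (isCanonical⁻ r′-canonical r∈ r∼r′))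

  ∑-R-equiv-canonical : {x r₀ : BF n} → r₀ ∈ D n → T (isCanonical r₀) → r₀ ∼ x →
    ∑[ r ∈ R n ] 𝟙 (equiv x r) ≡ 1
  ∑-R-equiv-canonical {x} {r₀} r₀∈ r₀-canonical r₀∼x = begin
    ∑[ r ∈ R n ] 𝟙 (equiv x r)
      ≡⟨ ∑-filterᵇ isCanonical (D n) (λ r → 𝟙 (equiv x r)) ⟩
    ∑[ r ∈ D n ] 𝟙 (isCanonical r) * 𝟙 (equiv x r)
      ≡⟨ ∑-cong-∈ (D n) (λ {r} r∈ → trans (sym (𝟙-∧ (isCanonical r) (equiv x r))) (cong 𝟙 (same-class r∈))) ⟩
    ∑[ r ∈ D n ] 𝟙 (eqF r₀ r)
      ≡⟨ ∑-eqF-D r₀ (∈D⇒isMonotone r₀∈) ⟩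
    1 ∎
    where
    open ≡-Reasoning
    same-class : ∀ {r} → r ∈ D n → isCanonical r ∧ equiv x r ≡ eqF r₀ r
    same-class {r} r∈ = T⇔⇒≡
      (λ r-canonical∧x≡r → let r-canonical , x≡r = to (T-∧ {isCanonical r}) r-canonical∧x≡r in
        eqF⁺ r₀ r (canonical-unique r₀∈ r∈ r₀-canonical r-canonical (∼-trans r₀∼x (equiv⁻ x r x≡r))))
      (λ r₀≡r → let r₀≗r = eqF⁻ r₀ r r₀≡r in from (T-∧ {isCanonical r})
        ( subst T (isCanonical-cong r₀≗r) r₀-canonical
        , equiv⁺ x r (∼-trans (∼-sym r₀∼x) (≗⇒∼ r₀≗r))))

  ∑-R-equiv : {x : BF n} → x ∈ D n → ∑[ r ∈ R n ] 𝟙 (equiv x r) ≡ 1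
  ∑-R-equiv x∈ = let r₀ , r₀∈ , r₀-canonical , r₀∼x = canonical-exists x∈ in
    ∑-R-equiv-canonical r₀∈ r₀-canonical r₀∼x

  ∑-D-by-classes : (H : BF n → ℕ) → H Preserves _∼_ ⟶ _≡_ → ∑ (D n) H ≡ ∑[ r ∈ R n ] γ r * H r
  ∑-D-by-classes H H-invariant = begin
    ∑ (D n) H
      ≡⟨ ∑-cong-∈ (D n) (λ {x} x∈ → sym (trans (cong (_* H x) (∑-R-equiv x∈)) (*-identityˡ (H x)))) ⟩
    ∑[ x ∈ D n ] (∑[ r ∈ R n ] 𝟙 (equiv x r)) * H x
      ≡⟨ ∑-cong (D n) (λ x → ∑-*ʳ (H x) (R n) (λ r → 𝟙 (equiv x r))) ⟩
    ∑[ x ∈ D n ] ∑[ r ∈ R n ] 𝟙 (equiv x r) * H x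
      ≡⟨ ∑-cong (D n) (λ x → ∑-cong (R n) (λ r → move-to-representative x r)) ⟩
    ∑[ x ∈ D n ] ∑[ r ∈ R n ] 𝟙 (equiv x r) * H r
      ≡⟨ ∑-comm (D n) (R n) (λ x r → 𝟙 (equiv x r) * H r) ⟩
    ∑[ r ∈ R n ] ∑[ x ∈ D n ] 𝟙 (equiv x r) * H r
      ≡⟨ ∑-cong (R n) (λ r → sym (∑-*ʳ (H r) (D n) (λ x → 𝟙 (equiv x r)))) ⟩
    ∑[ r ∈ R n ] (∑[ x ∈ D n ] 𝟙 (equiv x r)) * H r
      ≡⟨ ∑-cong (R n) (λ r → cong (_* H r) (sym (length-filterᵇ (λ x → equiv x r) (D n)))) ⟩
    ∑[ r ∈ R n ] γ r * H r ∎
    where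
    open ≡-Reasoning
    move-to-representative : ∀ x r → 𝟙 (equiv x r) * H x ≡ 𝟙 (equiv x r) * H r
    move-to-representative x r with equiv x r in x≡r
    ... | false = refl
    ... | true = cong (_+ 0) (H-invariant (equiv⁻ x r (from T-≡ x≡r)))

-- The congruences modulo m

[a+b]%m≡a%m : (a b m : ℕ) .{{_ : NonZero m}} → m ∣ b → (a + b) % m ≡ a % m
[a+b]%m≡a%m a .(q * m) m (divides-refl q) = [m+kn]%n≡m%n a q m

module _ {n : ℕ} where

  G-row-invariant : (w : BF n → ℕ) → w Preserves _∼_ ⟶ _≡_ →
    (λ x → ∑[ y ∈ D n ] w y * G x y) Preserves _∼_ ⟶ _≡_
  G-row-invariant w w-invariant {x} {x′} (mk∼ π π-perm x≗πx′) = begin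
    ∑[ y ∈ D n ] w y * G x y
      ≡⟨ ∑-cong (D n) (λ y → cong (w y *_) (G-cong x≗πx′ (λ _ → refl))) ⟩
    ∑[ y ∈ D n ] w y * G (act π x′) y
      ≡⟨ sym (∑-D-act π π-perm _ summand-ext) ⟩
    ∑[ y ∈ D n ] w (act π y) * G (act π x′) (act π y)
      ≡⟨ ∑-cong (D n) (λ y → cong₂ _*_ (w-invariant (mk∼ π π-perm (λ _ → refl))) (G-act π π-perm x′ y)) ⟩
    ∑[ y ∈ D n ] w y * G x′ y ∎
    where
    open ≡-Reasoning
    summand-ext : (λ y → w y * G (act π x′) y) Preserves _≗_ ⟶ _≡_
    summand-ext y≗y′ = cong₂ _*_ (w-invariant (≗⇒∼ y≗y′)) (G-cong (λ _ → refl) y≗y′)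

module _ (n m : ℕ) .{{_ : NonZero m}} where

  rowEc : BF n → ℕ
  rowEc x = ∑ (Ec n m) (G x)

  rowEc-invariant : rowEc Preserves _∼_ ⟶ _≡_
  rowEc-invariant {x} {x′} x∼x′ = begin
    rowEc x                            ≡⟨ ∑-filterᵇ (inEc m) (D n) (G x) ⟩
    ∑[ y ∈ D n ] 𝟙 (inEc m y) * G x y  ≡⟨ G-row-invariant (𝟙 ∘ inEc m) (cong 𝟙 ∘ inEc-resp-∼ m) x∼x′ ⟩
    ∑[ y ∈ D n ] 𝟙 (inEc m y) * G x′ y ≡⟨ sym (∑-filterᵇ (inEc m) (D n) (G x′)) ⟩
    rowEc x′ ∎
    where open ≡-Reasoning

  columnD : BF n → ℕ
  columnD y = ∑[ x ∈ D n ] G x y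

  columnD-invariant : columnD Preserves _∼_ ⟶ _≡_
  columnD-invariant {y} {y′} y∼y′ = begin
    columnD y               ≡⟨ ∑-cong (D n) (λ x → trans (G-comm x y) (sym (*-identityˡ (G y x)))) ⟩
    ∑[ x ∈ D n ] 1 * G y x  ≡⟨ G-row-invariant (λ _ → 1) (λ _ → refl) y∼y′ ⟩
    ∑[ x ∈ D n ] 1 * G y′ x ≡⟨ ∑-cong (D n) (λ x → trans (*-identityˡ (G y′ x)) (G-comm y′ x)) ⟩
    columnD y′ ∎
    where open ≡-Reasoning

  -- After grouping by classes each term is γ r * (𝟙 (not (inEc m r)) * H r), and
  -- either γ r ≡ 0 (mod m) or the indicator vanishes.
  m∣∑-outside-Ec : (H : BF n → ℕ) → H Preserves _∼_ ⟶ _≡_ → m ∣ ∑[ x ∈ D n ] 𝟙 (not (inEc m x)) * H x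
  m∣∑-outside-Ec H H-invariant = subst (m ∣_) (sym (∑-D-by-classes H′ H′-invariant))
    (∑-∣ m (R n) (λ r → γ r * H′ r) (λ {r} _ → m∣γ*H′ r))
    where
    H′ : BF n → ℕ
    H′ x = 𝟙 (not (inEc m x)) * H x
    H′-invariant : H′ Preserves _∼_ ⟶ _≡_
    H′-invariant x∼y = cong₂ (λ b k → 𝟙 (not b) * k) (inEc-resp-∼ m x∼y) (H-invariant x∼y)
    m∣γ*H′ : ∀ r → m ∣ γ r * H′ r
    m∣γ*H′ r with (γ r % m) ≡ᵇ 0 in γ%m≡ᵇ0
    ... | true = ∣m⇒∣m*n (1 * H r) (m%n≡0⇒n∣m (γ r) m (≡ᵇ⇒≡ (γ r % m) 0 (from T-≡ γ%m≡ᵇ0)))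
    ... | false = subst (m ∣_) (sym (*-zeroʳ (γ r))) (m ∣0)

  outsideRows outsideColumns : ℕ
  outsideRows = ∑[ x ∈ D n ] 𝟙 (not (inEc m x)) * rowEc x
  outsideColumns = ∑[ y ∈ D n ] 𝟙 (not (inEc m y)) * columnD y

  G×-D≡G×-Ec+outside : G× (D n) (D n) ≡ G× (Ec n m) (Ec n m) + (outsideRows + outsideColumns)
  G×-D≡G×-Ec+outside = begin
    ∑[ x ∈ D n ] ∑[ y ∈ D n ] G x y
      ≡⟨ ∑-cong (D n) (λ x → ∑-split (inEc m) (D n) (G x)) ⟩
    ∑[ x ∈ D n ] ((∑[ y ∈ D n ] 𝟙 (inEc m y) * G x y) + (∑[ y ∈ D n ] 𝟙 (not (inEc m y)) * G x y))
      ≡⟨ ∑-+ (D n) (λ x → ∑[ y ∈ D n ] 𝟙 (inEc m y) * G x y) (λ x → ∑[ y ∈ D n ] 𝟙 (not (inEc m y)) * G x y) ⟩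
    (∑[ x ∈ D n ] ∑[ y ∈ D n ] 𝟙 (inEc m y) * G x y) + (∑[ x ∈ D n ] ∑[ y ∈ D n ] 𝟙 (not (inEc m y)) * G x y)
      ≡⟨ cong₂ _+_ (∑-cong (D n) (λ x → sym (∑-filterᵇ (inEc m) (D n) (G x)))) outside-columns ⟩
    ∑ (D n) rowEc + outsideColumns
      ≡⟨ cong (_+ outsideColumns) (∑-split (inEc m) (D n) rowEc) ⟩
    ((∑[ x ∈ D n ] 𝟙 (inEc m x) * rowEc x) + outsideRows) + outsideColumns
      ≡⟨ cong (λ s → s + outsideRows + outsideColumns) (sym (∑-filterᵇ (inEc m) (D n) rowEc)) ⟩
    (∑ (Ec n m) rowEc + outsideRows) + outsideColumns
      ≡⟨ +-assoc (∑ (Ec n m) rowEc) outsideRows outsideColumns ⟩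
    G× (Ec n m) (Ec n m) + (outsideRows + outsideColumns) ∎
    where
    open ≡-Reasoning
    outside-columns : ∑[ x ∈ D n ] ∑[ y ∈ D n ] 𝟙 (not (inEc m y)) * G x y ≡ outsideColumns
    outside-columns = trans (∑-comm (D n) (D n) (λ x y → 𝟙 (not (inEc m y)) * G x y))
      (∑-cong (D n) (λ y → sym (∑-*ˡ (𝟙 (not (inEc m y))) (D n) (λ x → G x y))))

  G×-D≡G×-Ec-mod : G× (D n) (D n) % m ≡ G× (Ec n m) (Ec n m) % m
  G×-D≡G×-Ec-mod = trans (cong (_% m) G×-D≡G×-Ec+outside)
    ([a+b]%m≡a%m (G× (Ec n m) (Ec n m)) (outsideRows + outsideColumns) m
      (∣m∣n⇒∣m+n (m∣∑-outside-Ec rowEc rowEc-invariant) (m∣∑-outside-Ec columnD columnD-invariant)))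

  G×-Ec-by-classes : G× (Ec n m) (Ec n m) ≡ ∑[ x ∈ REc n m ] ∑[ y ∈ Ec n m ] γ x * G x y
  G×-Ec-by-classes = begin
    ∑ (Ec n m) rowEc
      ≡⟨ ∑-filterᵇ (inEc m) (D n) rowEc ⟩
    ∑[ x ∈ D n ] 𝟙 (inEc m x) * rowEc x
      ≡⟨ ∑-D-by-classes (λ x → 𝟙 (inEc m x) * rowEc x)
           (λ x∼y → cong₂ (λ b k → 𝟙 b * k) (inEc-resp-∼ m x∼y) (rowEc-invariant x∼y)) ⟩
    ∑[ r ∈ R n ] γ r * (𝟙 (inEc m r) * rowEc r)
      ≡⟨ ∑-cong (R n) (λ r → *-left-comm (γ r) (𝟙 (inEc m r)) (rowEc r)) ⟩
    ∑[ r ∈ R n ] 𝟙 (inEc m r) * (γ r * rowEc r)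
      ≡⟨ sym (∑-filterᵇ (inEc m) (R n) (λ r → γ r * rowEc r)) ⟩
    ∑[ r ∈ REc n m ] γ r * rowEc r
      ≡⟨ ∑-cong (REc n m) (λ r → ∑-*ˡ (γ r) (Ec n m) (G r)) ⟩
    ∑[ x ∈ REc n m ] ∑[ y ∈ Ec n m ] γ x * G x y ∎
    where open ≡-Reasoning

theorem7 : (n m : ℕ) .{{_ : NonZero m}} → 1 < m →
    (d (suc (suc n)) % m ≡ G× (D n) (D n) % m)
    × (G× (D n) (D n) % m ≡ G× (Ec n m) (Ec n m) % m)
    × (d (suc (suc n)) % m
        ≡ sum (map (λ x → sum (map (λ y → γ x * G x y) (Ec n m))) (REc n m)) % m)
theorem7 n m _ = d≡G×-D , G×-D≡G×-Ec-mod n m ,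
  trans d≡G×-D (trans (G×-D≡G×-Ec-mod n m) (cong (_% m) (G×-Ec-by-classes n m)))
  where
  d≡G×-D : d (suc (suc n)) % m ≡ G× (D n) (D n) % m
  d≡G×-D = cong (_% m) (d-suc-suc n)
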